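{- Let $n\ge2$ and let $\bar G$ be an orientation of the type $B_n$ Coxeter diagram. If $x,y\in\mathcal T$, then $I(x\vee y)=I(x)\cup I(y)$; if $x,y\in\mathcal B$, then $I(x\wedge y)=I(x)\cap I(y)$, where $\vee,\wedge$ denote join and meet in weak order on $B_n$.
   Context: $B_n$ is the group of signed permutations: bijections $\pi$ of $\{ -n,\dots,-1,1,\dots,n\}$ with $\pi(-i)=-\pi(i)$, written in one-line notation $\pi_{ -n}\cdots\pi_{ -1}\pi_1\cdots\pi_n$. The inversion set $I(\pi)$: for $0<i<j$, $e_j-e_i\in I(\pi)$ iff $j$ precedes $i$ in the one-line notation; $e_i\in I(\pi)$ iff $i$ precedes $-i$; $e_j+e_i\in I(\pi)$ ($i\ne j$) iff $i$ precedes $-j$. Weak order: $\pi\le\sigma$ iff $I(\pi)\subseteq I(\sigma)$; it is a lattice. The Coxeter diagram is the path $s_0,\dots,s_{n-1}$; an orientation $\bar G$ chooses for each $1\le i\le n-1$ either $s_{i-1}\to s_i$ or $s_{i-1}\leftarrow s_i$. Define complementary subsets $D,U$ of $\{\pm1,\dots,\pm(n-1)\}$: if $s_{i-1}\to s_i$ then $i\in D$, $-i\in U$; otherwise $i\in U$, $-i\in D$. For positions $p<q<r$ in $\{ -n,\dots,-1,1,\dots,n\}$: $\pi$ contains $\bar231$ if some such positions have $\pi_r<\pi_p<\pi_q$ with $\pi_p\in U$; $31\underline2$ if $\pi_q<\pi_r<\pi_p$ with $\pi_r\in D$; $\bar213$ if $\pi_q<\pi_p<\pi_r$ with $\pi_p\in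 U$; $13\underline2$ if $\pi_p<\pi_r<\pi_q$ with $\pi_r\in D$. $\mathcal B$ is the set of signed permutations avoiding $\bar231$ and $31\underline2$; $\mathcal T$ is the set avoiding $\bar213$ and $13\underline2$. -}

module Defs where

open import Data.Nat as ℕ using (ℕ; suc; pred)
open import Data.Integer as ℤ using (ℤ; +_; -_; ∣_∣)
open import Data.Fin as Fin using (Fin; splitAt; opposite; toℕ)
open import Data.Bool using (Bool; true; false)
open import Data.Sum using (_⊎_; inj₁; inj₂)
open import Data.Product using (Σ; ∃; ∃-syntax; _×_; _,_)
open import Relation.Binary.PropositionalEquality using (_≡_)
open import Relation.Nullary using (¬_)

-- A signed permutation of [±n], given by its positive half π_1 ⋯ π_n
-- (values are nonzero integers in [-n,n]); π(-i) = -π(i) is built in.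
record SignedPerm (n : ℕ) : Set where
  field
    val      : Fin n → ℤ
    inRange  : ∀ i → 1 ℕ.≤ ∣ val i ∣ × ∣ val i ∣ ℕ.≤ n
    absInj   : ∀ i j → ∣ val i ∣ ≡ ∣ val j ∣ → i ≡ j
open SignedPerm public

-- Full one-line notation π_{-n} ⋯ π_{-1} π_1 ⋯ π_n, indexed by Fin (n + n):
-- index k < n is position -(n - k), index n + b is position b + 1.
oneLine : ∀ {n} → SignedPerm n → Fin (n ℕ.+ n) → ℤ
oneLine {n} π k with splitAt n k
... | inj₁ a = - val π (opposite a)
... | inj₂ b = val π b

Precedes : ∀ {n} → SignedPerm n → ℤ → ℤ → Set
Precedes π a b = ∃[ p ] ∃[ q ] (p Fin.< q × oneLine π p ≡ a × oneLine π q ≡ b)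

-- Positive roots of B_n (indices are natural numbers; range conditions are
-- part of the inversion predicate).
data Root : Set where
  e     : ℕ → Root
  eDiff : ℕ → ℕ → Root      -- eDiff j i = e_j - e_i  (0 < i < j)
  eSum  : ℕ → ℕ → Root      -- eSum j i = e_j + e_i   (0 < i < j)

Inv : ∀ {n} → SignedPerm n → Root → Set
Inv {n} π (e i)       = 1 ℕ.≤ i × i ℕ.≤ n × Precedes π (+ i) (- (+ i))
Inv {n} π (eDiff j i) = 1 ℕ.≤ i × i ℕ.< j × j ℕ.≤ n × Precedes π (+ j) (+ i)
Inv {n} π (eSum j i)  = 1 ℕ.≤ i × i ℕ.< j × j ℕ.≤ n × Precedes π (+ i) (- (+ j))

_≤w_ : ∀ {n} → SignedPerm n → SignedPerm n → Set
π ≤w σ = ∀ r → Inv π r → Inv σ r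

IsJoin : ∀ {n} → SignedPerm n → SignedPerm n → SignedPerm n → Set
IsJoin x y z = x ≤w z × y ≤w z × (∀ w → x ≤w w → y ≤w w → z ≤w w)

IsMeet : ∀ {n} → SignedPerm n → SignedPerm n → SignedPerm n → Set
IsMeet x y z = z ≤w x × z ≤w y × (∀ w → w ≤w x → w ≤w y → w ≤w z)

-- Orientation of the B_n Coxeter diagram s_0 - s_1 - ⋯ - s_{n-1}:
-- for k : Fin (n - 1), with i = k + 1, o k ≡ true means s_{i-1} → s_i,
-- o k ≡ false means s_{i-1} ← s_i.
Orientation : ℕ → Set
Orientation n = Fin (pred n) → Bool

InD : ∀ {n} → Orientation n → ℤ → Set
InD o a = ∃[ k ] ((a ≡ + suc (toℕ k) × o k ≡ true) ⊎ (a ≡ - (+ suc (toℕ k)) × o k ≡ false))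

InU : ∀ {n} → Orientation n → ℤ → Set
InU o a = ∃[ k ] ((a ≡ + suc (toℕ k) × o k ≡ false) ⊎ (a ≡ - (+ suc (toℕ k)) × o k ≡ true))

∃Pos3 : (n : ℕ) → (Fin (n ℕ.+ n) → Fin (n ℕ.+ n) → Fin (n ℕ.+ n) → Set) → Set
∃Pos3 n P = Σ (Fin (n ℕ.+ n)) λ p → Σ (Fin (n ℕ.+ n)) λ q → Σ (Fin (n ℕ.+ n)) λ r →
  p Fin.< q × q Fin.< r × P p q r

module _ {n : ℕ} (o : Orientation n) (π : SignedPerm n) where
  private
    v = oneLine π

  Contains-bar231 : Set
  Contains-bar231 = ∃Pos3 n (λ p q r →
    v r ℤ.< v p × v p ℤ.< v q × InU {n} o (v p))

  Contains-31under2 : Set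
  Contains-31under2 = ∃Pos3 n (λ p q r →
    v q ℤ.< v r × v r ℤ.< v p × InD {n} o (v r))

  Contains-bar213 : Set
  Contains-bar213 = ∃Pos3 n (λ p q r →
    v q ℤ.< v p × v p ℤ.< v r × InU {n} o (v p))

  Contains-13under2 : Set
  Contains-13under2 = ∃Pos3 n (λ p q r →
    v p ℤ.< v r × v r ℤ.< v q × InD {n} o (v r))

  In𝓑 : Set
  In𝓑 = ¬ Contains-bar231 × ¬ Contains-31under2

  In𝓣 : Set
  In𝓣 = ¬ Contains-bar213 × ¬ Contains-13under2

{-# OPTIONS --safe #-}
module Submission where

-- The one-line notation of a signed permutation is a linear order on the entries ±1, …, ±n
-- that negation reverses, and every such order is the one-line order of a signed permutation
-- (list the entries by rank). An inversion is a pair b < a with a placed before b. For x, y ∈ 𝓣,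
-- place a before b when b < a and x or y does so, or when a < b and both x and y do so. This
-- can only fail to be transitive on a triple lo < mid < hi that one of x, y lists as
-- lo … hi … mid and the other as mid … lo … hi; but then mid ∈ D gives a 13̲2 in the first and
-- mid ∈ U a 2̄13 in the second. So it is the one-line order of some w with I(w) = I(x) ∪ I(y),
-- and the join lies below w. For meets, π ↦ −π (that is, w₀π) complements inversion sets, hence
-- reverses weak order, and it sends 𝓑 for Ḡ to 𝓣 for the reversed orientation.

open import Defs
open import Data.Nat using (ℕ; _≤_)
open import Data.Product using (_×_)
open import Data.Sum using (_⊎_)
open import Function.Bundles using (_⇔_)

open import Data.Bool using (true; false; not)
open import Data.Bool.Properties using (not-injective)
open import Data.Fin as Fin using (Fin; splitAt; opposite; toℕ; fromℕ<; _↑ˡ_; _↑ʳ_)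
import Data.Fin.Properties as Fin
open import Data.Fin.Permutation using (reverse)
open import Data.Integer as ℤ using (ℤ; +_; -_; ∣_∣; -[1+_]; +[1+_]; +<+)
import Data.Integer.Properties as ℤ
open import Data.Nat as ℕ using (zero; suc; pred; s≤s)
import Data.Nat.Properties as ℕ
open import Algebra.Properties.CommutativeMonoid.Sum ℕ.+-0-commutativeMonoid
  using (sum-syntax; ∑-permute; sum-cong-≗)
open import Data.Product using (Σ-syntax; ∃-syntax; _,_; proj₁; proj₂; uncurry)
open import Data.Sum using (inj₁; inj₂; [_,_]′)
open import Data.Empty using (⊥; ⊥-elim)
open import Function using (_∘_; case_of_; mk⇔; Equivalence; Injective)
open import Relation.Binary using (tri<; tri≈; tri>)
open import Relation.Binary.PropositionalEquality
open import Relation.Nullary using (¬_; ¬?; Dec; yes; no; contradiction)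
open import Relation.Nullary.Decidable using (_×-dec_; _⊎-dec_)
open import Relation.Unary using (Decidable)

variable
  n : ℕ
  a b c : ℤ

record Entry (n : ℕ) (a : ℤ) : Set where
  constructor entry
  field
    nonzero : 1 ≤ ∣ a ∣
    bounded : ∣ a ∣ ≤ n

Entry-neg : Entry n a → Entry n (- a)
Entry-neg {a = a} (entry 1≤∣a∣ ∣a∣≤n) =
  entry (subst (1 ≤_) ∣a∣≡∣-a∣ 1≤∣a∣) (subst (_≤ _) ∣a∣≡∣-a∣ ∣a∣≤n)
  where
  ∣a∣≡∣-a∣ : ∣ a ∣ ≡ ∣ - a ∣
  ∣a∣≡∣-a∣ = sym (ℤ.∣-i∣≡∣i∣ a)

Entry⇒≢0 : Entry n a → a ≢ + 0
Entry⇒≢0 (entry () _) refl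

val-entry : (π : SignedPerm n) (i : Fin n) → Entry n (val π i)
val-entry π i = entry (proj₁ (inRange π i)) (proj₂ (inRange π i))

magnitude : Entry n a → Fin n
magnitude (entry 1≤∣a∣ ∣a∣≤n) = fromℕ< (pred< 1≤∣a∣ ∣a∣≤n)
  where
  pred< : ∀ {x} → 1 ≤ x → x ≤ n → pred x ℕ.< n
  pred< {x = suc _} _ x≤n = x≤n

magnitude-injective : (a∈ : Entry n a) (b∈ : Entry n b) →
                      magnitude a∈ ≡ magnitude b∈ → ∣ a ∣ ≡ ∣ b ∣
magnitude-injective (entry 1≤∣a∣ _) (entry 1≤∣b∣ _) eq =
  pred-injective 1≤∣a∣ 1≤∣b∣ (Fin.fromℕ<-injective _ _ _ _ eq)
  where
  pred-injective : ∀ {x y} → 1 ≤ x → 1 ≤ y → pred x ≡ pred y → x ≡ y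
  pred-injective {suc _} {suc _} _ _ = cong suc

∣i∣≡∣j∣⇒i≡j⊎i≡-j : ∀ i j → ∣ i ∣ ≡ ∣ j ∣ → i ≡ j ⊎ i ≡ - j
∣i∣≡∣j∣⇒i≡j⊎i≡-j (+ _)    (+ _)    refl = inj₁ refl
∣i∣≡∣j∣⇒i≡j⊎i≡-j (+ _)    -[1+ _ ] refl = inj₂ refl
∣i∣≡∣j∣⇒i≡j⊎i≡-j -[1+ _ ] (+ _)    refl = inj₂ refl
∣i∣≡∣j∣⇒i≡j⊎i≡-j -[1+ _ ] -[1+ _ ] refl = inj₁ refl

a≡-a⇒a≡0 : a ≡ - a → a ≡ + 0
a≡-a⇒a≡0 {+ 0} _ = refl

-a≡b⇒a≡-b : - a ≡ b → a ≡ - b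
-a≡b⇒a≡-b {a} refl = sym (ℤ.neg-involutive a)

Fin-injective⇒surjective : ∀ {m} {f : Fin m → Fin m} → Injective _≡_ _≡_ f →
                           ∀ k → ∃[ c ] f c ≡ k
Fin-injective⇒surjective {suc m} {f} f-inj k with Fin.any? (λ c → f c Fin.≟ k)
... | yes hit  = hit
... | no  miss = contradiction (Fin.injective⇒≤ punchOut-inj) ℕ.1+n≰n
  where
  k≢f : ∀ c → k ≢ f c
  k≢f c eq = miss (c , sym eq)
  punchOut-inj : Injective _≡_ _≡_ (λ c → Fin.punchOut (k≢f c))
  punchOut-inj eq = f-inj (Fin.punchOut-injective (k≢f _) (k≢f _) eq)

data Half (m : ℕ) : Fin (m ℕ.+ m) → Set where
  left  : ∀ i → Half m (i ↑ˡ m)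
  right : ∀ i → Half m (m ↑ʳ i)

half : ∀ m k → Half m k
half m k with splitAt m k in eq
... | inj₁ i = subst (Half m) (Fin.splitAt⁻¹-↑ˡ eq) (left i)
... | inj₂ i = subst (Half m) (Fin.splitAt⁻¹-↑ʳ eq) (right i)

opposite-↑ˡ : ∀ {m} (i : Fin m) → opposite (i ↑ˡ m) ≡ m ↑ʳ opposite i
opposite-↑ˡ {m} i = Fin.toℕ-injective (begin
  toℕ (opposite (i ↑ˡ m))        ≡⟨ Fin.opposite-prop (i ↑ˡ m) ⟩
  (m ℕ.+ m) ℕ.∸ suc (toℕ (i ↑ˡ m)) ≡⟨ cong (λ t → (m ℕ.+ m) ℕ.∸ suc t) (Fin.toℕ-↑ˡ i m) ⟩
  (m ℕ.+ m) ℕ.∸ suc (toℕ i)      ≡⟨ ℕ.+-∸-assoc m (Fin.toℕ<n i) ⟩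
  m ℕ.+ (m ℕ.∸ suc (toℕ i))      ≡⟨ cong (m ℕ.+_) (Fin.opposite-prop i) ⟨
  m ℕ.+ toℕ (opposite i)         ≡⟨ Fin.toℕ-↑ʳ m (opposite i) ⟨
  toℕ (m ↑ʳ opposite i)          ∎)
  where open ≡-Reasoning

opposite-↑ʳ : ∀ {m} (i : Fin m) → opposite (m ↑ʳ i) ≡ opposite i ↑ˡ m
opposite-↑ʳ {m} i = begin
  opposite (m ↑ʳ i)                     ≡⟨ cong (opposite ∘ (m ↑ʳ_)) (Fin.opposite-involutive i) ⟨
  opposite (m ↑ʳ opposite (opposite i)) ≡⟨ cong opposite (opposite-↑ˡ (opposite i)) ⟨
  opposite (opposite (opposite i ↑ˡ m)) ≡⟨ Fin.opposite-involutive _ ⟩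
  opposite i ↑ˡ m                       ∎
  where open ≡-Reasoning

↑ʳ≢↑ˡ : ∀ {m} (i j : Fin m) → m ↑ʳ i ≢ j ↑ˡ m
↑ʳ≢↑ˡ {m} i j eq
  with () ← trans (sym (Fin.splitAt-↑ʳ m m i)) (trans (cong (splitAt m) eq) (Fin.splitAt-↑ˡ m j m))

opposite-injective : ∀ {m} → Injective _≡_ _≡_ (opposite {m})
opposite-injective {x = i} {j} eq = begin
  i                     ≡⟨ Fin.opposite-involutive i ⟨
  opposite (opposite i) ≡⟨ cong opposite eq ⟩
  opposite (opposite j) ≡⟨ Fin.opposite-involutive j ⟩
  j                     ∎
  where open ≡-Reasoning

opposite-< : ∀ {m} {k l : Fin m} → k Fin.< l → opposite l Fin.< opposite k
opposite-< {k = k} {l} k<l rewrite Fin.opposite-prop k | Fin.opposite-prop l =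
  ℕ.∸-monoʳ-< (s≤s k<l) (Fin.toℕ<n l)

module _ (π : SignedPerm n) where

  oneLine-↑ˡ : ∀ i → oneLine π (i ↑ˡ n) ≡ - val π (opposite i)
  oneLine-↑ˡ i rewrite Fin.splitAt-↑ˡ n i n = refl

  oneLine-↑ʳ : ∀ i → oneLine π (n ↑ʳ i) ≡ val π i
  oneLine-↑ʳ i rewrite Fin.splitAt-↑ʳ n n i = refl

  oneLine-opposite : ∀ k → oneLine π (opposite k) ≡ - oneLine π k
  oneLine-opposite k with half n k
  ... | left i = begin
    oneLine π (opposite (i ↑ˡ n)) ≡⟨ cong (oneLine π) (opposite-↑ˡ i) ⟩
    oneLine π (n ↑ʳ opposite i)   ≡⟨ oneLine-↑ʳ (opposite i) ⟩
    val π (opposite i)            ≡⟨ ℤ.neg-involutive _ ⟨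
    - - val π (opposite i)        ≡⟨ cong -_ (oneLine-↑ˡ i) ⟨
    - oneLine π (i ↑ˡ n)          ∎
    where open ≡-Reasoning
  ... | right i = begin
    oneLine π (opposite (n ↑ʳ i))   ≡⟨ cong (oneLine π) (opposite-↑ʳ i) ⟩
    oneLine π (opposite i ↑ˡ n)     ≡⟨ oneLine-↑ˡ (opposite i) ⟩
    - val π (opposite (opposite i)) ≡⟨ cong (-_ ∘ val π) (Fin.opposite-involutive i) ⟩
    - val π i                       ≡⟨ cong -_ (oneLine-↑ʳ i) ⟨
    - oneLine π (n ↑ʳ i)            ∎
    where open ≡-Reasoning

  oneLine-entry : ∀ k → Entry n (oneLine π k)
  oneLine-entry k with half n k
  ... | left i  = subst (Entry n) (sym (oneLine-↑ˡ i)) (Entry-neg (val-entry π (opposite i)))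
  ... | right i = subst (Entry n) (sym (oneLine-↑ʳ i)) (val-entry π i)

  val-injective : ∀ {i j} → val π i ≡ val π j → i ≡ j
  val-injective eq = absInj π _ _ (cong ∣_∣ eq)

  val≢-val : ∀ i j → val π i ≢ - val π j
  val≢-val i j eq with absInj π i j (trans (cong ∣_∣ eq) (ℤ.∣-i∣≡∣i∣ (val π j)))
  ... | refl = Entry⇒≢0 (val-entry π i) (a≡-a⇒a≡0 eq)

  oneLine-injective : Injective _≡_ _≡_ (oneLine π)
  oneLine-injective {k} {l} eq with half n k | half n l
  ... | left i | left j = cong (_↑ˡ n) (opposite-injective
          (val-injective (ℤ.neg-injective (trans (sym (oneLine-↑ˡ i)) (trans eq (oneLine-↑ˡ j))))))
  ... | left i | right j = ⊥-elim (val≢-val j (opposite i)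
          (trans (sym (oneLine-↑ʳ j)) (trans (sym eq) (oneLine-↑ˡ i))))
  ... | right i | left j = ⊥-elim (val≢-val i (opposite j)
          (trans (sym (oneLine-↑ʳ i)) (trans eq (oneLine-↑ˡ j))))
  ... | right i | right j = cong (n ↑ʳ_)
          (val-injective (trans (sym (oneLine-↑ʳ i)) (trans eq (oneLine-↑ʳ j))))

  magnitude-val-injective : Injective _≡_ _≡_ (magnitude ∘ val-entry π)
  magnitude-val-injective {i} {j} = absInj π i j ∘ magnitude-injective (val-entry π i) (val-entry π j)

  oneLine-surjective : Entry n a → ∃[ k ] oneLine π k ≡ a
  oneLine-surjective {a} a∈
    with i , eq ← Fin-injective⇒surjective magnitude-val-injective (magnitude a∈)
    with ∣i∣≡∣j∣⇒i≡j⊎i≡-j (val π i) a (magnitude-injective (val-entry π i) a∈ eq)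
  ... | inj₁ val≡a  = n ↑ʳ i , trans (oneLine-↑ʳ i) val≡a
  ... | inj₂ val≡-a = opposite (n ↑ʳ i) , (begin
    oneLine π (opposite (n ↑ʳ i)) ≡⟨ oneLine-opposite (n ↑ʳ i) ⟩
    - oneLine π (n ↑ʳ i)          ≡⟨ cong -_ (trans (oneLine-↑ʳ i) val≡-a) ⟩
    - - a                         ≡⟨ ℤ.neg-involutive a ⟩
    a                             ∎)
    where open ≡-Reasoning

  Precedes-entries : Precedes π a b → Entry n a × Entry n b
  Precedes-entries (p , q , _ , refl , refl) = oneLine-entry p , oneLine-entry q

  Precedes-irrefl : ¬ Precedes π a a
  Precedes-irrefl (p , q , p<q , refl , eq) = Fin.<⇒≢ p<q (oneLine-injective (sym eq))

  Precedes-chain : Precedes π a b → Precedes π b c →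
    ∃Pos3 n (λ p q r → oneLine π p ≡ a × oneLine π q ≡ b × oneLine π r ≡ c)
  Precedes-chain (p , q , p<q , refl , refl) (q′ , r , q′<r , eq , refl)
    with oneLine-injective eq
  ... | refl = p , q , r , p<q , q′<r , refl , refl , refl

  Precedes-trans : Precedes π a b → Precedes π b c → Precedes π a c
  Precedes-trans ab bc with p , _ , r , p<q , q<r , a≡ , _ , c≡ ← Precedes-chain ab bc =
    p , r , Fin.<-trans p<q q<r , a≡ , c≡

  Precedes-asym : Precedes π a b → ¬ Precedes π b a
  Precedes-asym ab ba = Precedes-irrefl (Precedes-trans ab ba)

  Precedes-total : Entry n a → Entry n b → a ≢ b → Precedes π a b ⊎ Precedes π b a
  Precedes-total a∈ b∈ a≢b with p , refl ← oneLine-surjective a∈ | q , refl ← oneLine-surjective b∈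
    with Fin.<-cmp p q
  ... | tri< p<q _ _ = inj₁ (p , q , p<q , refl , refl)
  ... | tri≈ _ refl _ = contradiction refl a≢b
  ... | tri> _ _ q<p = inj₂ (q , p , q<p , refl , refl)

  Precedes-neg : Precedes π a b → Precedes π (- b) (- a)
  Precedes-neg (p , q , p<q , refl , refl) =
    opposite q , opposite p , opposite-< p<q , oneLine-opposite q , oneLine-opposite p

  Precedes? : ∀ a b → Dec (Precedes π a b)
  Precedes? a b = Fin.any? λ p → Fin.any? λ q →
    p Fin.<? q ×-dec oneLine π p ℤ.≟ a ×-dec oneLine π q ℤ.≟ b

indicator : ∀ {A : Set} → Dec A → ℕ
indicator (yes _) = 1
indicator (no _)  = 0

count : ∀ {m} {P : Fin m → Set} → Decidable P → ℕ
count {m} P? = ∑[ c < m ] indicator (P? c)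

indicator-cong : ∀ {A B : Set} (A? : Dec A) (B? : Dec B) → A ⇔ B → indicator A? ≡ indicator B?
indicator-cong (yes _) (yes _) _   = refl
indicator-cong (no _)  (no _)  _   = refl
indicator-cong (yes a) (no ¬b) A⇔B = contradiction (Equivalence.to A⇔B a) ¬b
indicator-cong (no ¬a) (yes b) A⇔B = contradiction (Equivalence.from A⇔B b) ¬a

count-cong : ∀ {m} {P Q : Fin m → Set} (P? : Decidable P) (Q? : Decidable Q) →
             (∀ c → P c ⇔ Q c) → count P? ≡ count Q?
count-cong P? Q? P⇔Q = sum-cong-≗ λ c → indicator-cong (P? c) (Q? c) (P⇔Q c)

count-opposite : ∀ {m} {P : Fin m → Set} (P? : Decidable P) → count (P? ∘ opposite) ≡ count P?
count-opposite P? = sym (∑-permute (indicator ∘ P?) reverse)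

count-mono-≤ : ∀ {m} {P Q : Fin m → Set} (P? : Decidable P) (Q? : Decidable Q) →
               (∀ c → P c → Q c) → count P? ≤ count Q?
count-mono-≤ {zero} P? Q? P⊆Q = ℕ.z≤n
count-mono-≤ {suc m} P? Q? P⊆Q with P? Fin.zero | Q? Fin.zero
... | yes p | no ¬q = contradiction (P⊆Q Fin.zero p) ¬q
... | yes _ | yes _ = s≤s (count-mono-≤ (P? ∘ Fin.suc) (Q? ∘ Fin.suc) (P⊆Q ∘ Fin.suc))
... | no _  | yes _ = ℕ.m≤n⇒m≤1+n (count-mono-≤ (P? ∘ Fin.suc) (Q? ∘ Fin.suc) (P⊆Q ∘ Fin.suc))
... | no _  | no _  = count-mono-≤ (P? ∘ Fin.suc) (Q? ∘ Fin.suc) (P⊆Q ∘ Fin.suc)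

count-mono-< : ∀ {m} {P Q : Fin m → Set} (P? : Decidable P) (Q? : Decidable Q) →
               (∀ c → P c → Q c) → ∀ {c₀} → ¬ P c₀ → Q c₀ → count P? ℕ.< count Q?
count-mono-< P? Q? P⊆Q {Fin.zero} ¬p q with P? Fin.zero | Q? Fin.zero
... | yes p | _     = contradiction p ¬p
... | no _  | no ¬q = contradiction q ¬q
... | no _  | yes _ = s≤s (count-mono-≤ (P? ∘ Fin.suc) (Q? ∘ Fin.suc) (P⊆Q ∘ Fin.suc))
count-mono-< P? Q? P⊆Q {Fin.suc c₀} ¬p q with P? Fin.zero | Q? Fin.zero
... | yes p | no ¬q = contradiction (P⊆Q Fin.zero p) ¬q
... | yes _ | yes _ = s≤s (count-mono-< (P? ∘ Fin.suc) (Q? ∘ Fin.suc) (P⊆Q ∘ Fin.suc) ¬p q)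
... | no _  | yes _ = ℕ.m≤n⇒m≤1+n (count-mono-< (P? ∘ Fin.suc) (Q? ∘ Fin.suc) (P⊆Q ∘ Fin.suc) ¬p q)
... | no _  | no _  = count-mono-< (P? ∘ Fin.suc) (Q? ∘ Fin.suc) (P⊆Q ∘ Fin.suc) ¬p q

count-insert : ∀ {m} {P Q : Fin m → Set} (P? : Decidable P) (Q? : Decidable Q) →
               ∀ {c₀} → ¬ P c₀ → Q c₀ → (∀ c → c ≢ c₀ → P c ⇔ Q c) →
               suc (count P?) ≡ count Q?
count-insert P? Q? {Fin.zero} ¬p q agree with P? Fin.zero | Q? Fin.zero
... | yes p | _     = contradiction p ¬p
... | no _  | no ¬q = contradiction q ¬q
... | no _  | yes _ = cong suc (count-cong (P? ∘ Fin.suc) (Q? ∘ Fin.suc) λ c → agree (Fin.suc c) λ ())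
count-insert P? Q? {Fin.suc c₀} ¬p q agree = trans (sym (ℕ.+-suc _ _)) (cong₂ ℕ._+_
  (indicator-cong (P? Fin.zero) (Q? Fin.zero) (agree Fin.zero λ ()))
  (count-insert (P? ∘ Fin.suc) (Q? ∘ Fin.suc) ¬p q
     λ c c≢c₀ → agree (Fin.suc c) (c≢c₀ ∘ Fin.suc-injective)))

count-complement : ∀ {m} {P : Fin m → Set} (P? : Decidable P) → count P? ℕ.+ count (¬? ∘ P?) ≡ m
count-complement {zero}  P? = refl
count-complement {suc m} P? with P? Fin.zero
... | yes _ = cong suc (count-complement (P? ∘ Fin.suc))
... | no _  = trans (ℕ.+-suc _ _) (cong suc (count-complement (P? ∘ Fin.suc)))

identity : ∀ n → SignedPerm n
identity n = record
  { val     = λ i → + suc (toℕ i)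
  ; inRange = λ i → s≤s ℕ.z≤n , Fin.toℕ<n i
  ; absInj  = λ i j → Fin.toℕ-injective ∘ ℕ.suc-injective
  }

record IsSignedLinearOrder (n : ℕ) (R : ℤ → ℤ → Set) : Set where
  field
    R?         : ∀ a b → Dec (R a b)
    irrefl     : ¬ R a a
    transitive : Entry n a → Entry n b → Entry n c → R a b → R b c → R a c
    total      : Entry n a → Entry n b → a ≢ b → R a b ⊎ R b a
    neg        : R a b → R (- b) (- a)

  asym : Entry n a → Entry n b → R a b → ¬ R b a
  asym a∈ b∈ ab ba = irrefl (transitive a∈ b∈ a∈ ab ba)

  neg⇔ : R (- b) (- a) ⇔ R a b
  neg⇔ {b} {a} = mk⇔ (subst₂ R (ℤ.neg-involutive a) (ℤ.neg-involutive b) ∘ neg) neg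

-- rank a counts the entries below a, and w puts every entry at the position given by its rank;
-- as negation reverses R, rank (- a) = 2n - 1 - rank a, which makes w a signed permutation.
private
  module Realise {R : ℤ → ℤ → Set} (S : IsSignedLinearOrder n R) where
    open IsSignedLinearOrder S

    enum : Fin (n ℕ.+ n) → ℤ
    enum = oneLine (identity n)

    enum-entry : ∀ c → Entry n (enum c)
    enum-entry = oneLine-entry (identity n)

    rank : ℤ → ℕ
    rank a = count (λ c → R? (enum c) a)

    rank-mono : Entry n a → Entry n b → R a b → rank a ℕ.< rank b
    rank-mono a∈ b∈ ab with c₀ , refl ← oneLine-surjective (identity n) a∈ =
      count-mono-< _ _ (λ c r → transitive (enum-entry c) a∈ b∈ r ab) {c₀} irrefl ab

    rank-neg : Entry n a → rank (- a) ℕ.+ suc (rank a) ≡ n ℕ.+ n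
    rank-neg {a} a∈ with c₀ , refl ← oneLine-surjective (identity n) a∈ = begin
      rank (- a) ℕ.+ suc (rank a)    ≡⟨ cong (ℕ._+ suc (rank a)) rank-neg≡count-above ⟩
      count above? ℕ.+ suc (rank a)  ≡⟨ ℕ.+-suc _ _ ⟩
      suc (count above?) ℕ.+ rank a  ≡⟨ cong (ℕ._+ rank a) (count-insert above? (¬? ∘ below?)
                                                              irrefl irrefl above⇔¬below) ⟩
      count (¬? ∘ below?) ℕ.+ rank a ≡⟨ ℕ.+-comm _ (rank a) ⟩
      rank a ℕ.+ count (¬? ∘ below?) ≡⟨ count-complement below? ⟩
      n ℕ.+ n                        ∎
      where
      open ≡-Reasoning
      above? below? : Decidable _
      above? c = R? a (enum c)
      below? c = R? (enum c) a
      below-a⇔above : ∀ c → R (enum (opposite c)) (- a) ⇔ R a (enum c)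
      below-a⇔above c = subst (λ e → R e (- a) ⇔ R a (enum c)) (sym (oneLine-opposite (identity n) c)) neg⇔
      rank-neg≡count-above : rank (- a) ≡ count above?
      rank-neg≡count-above = begin
        rank (- a)                                 ≡⟨ count-opposite (λ c → R? (enum c) (- a)) ⟨
        count (λ c → R? (enum (opposite c)) (- a)) ≡⟨ count-cong _ _ below-a⇔above ⟩
        count above?                               ∎
      above⇔¬below : ∀ c → c ≢ c₀ → R a (enum c) ⇔ (¬ R (enum c) a)
      above⇔¬below c c≢c₀ = mk⇔ (asym a∈ (enum-entry c))
        λ ¬below → case total a∈ (enum-entry c) (c≢c₀ ∘ sym ∘ oneLine-injective (identity n)) of λ where
          (inj₁ above) → above
          (inj₂ below) → contradiction below ¬below

    rank< : Entry n a → rank a ℕ.< n ℕ.+ n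
    rank< {a} a∈ = ℕ.≤-trans (ℕ.m≤n+m _ (rank (- a))) (ℕ.≤-reflexive (rank-neg a∈))

    rank-injective : Entry n a → Entry n b → rank a ≡ rank b → a ≡ b
    rank-injective {a} {b} a∈ b∈ eq with a ℤ.≟ b
    ... | yes a≡b = a≡b
    ... | no a≢b with total a∈ b∈ a≢b
    ...   | inj₁ ab = contradiction eq (ℕ.<⇒≢ (rank-mono a∈ b∈ ab))
    ...   | inj₂ ba = contradiction (sym eq) (ℕ.<⇒≢ (rank-mono b∈ a∈ ba))

    rank-<⇒R : Entry n a → Entry n b → rank a ℕ.< rank b → R a b
    rank-<⇒R {a} {b} a∈ b∈ a<b with a ℤ.≟ b
    ... | yes refl = contradiction a<b (ℕ.<-irrefl refl)
    ... | no a≢b with total a∈ b∈ a≢b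
    ...   | inj₁ ab = ab
    ...   | inj₂ ba = contradiction (rank-mono b∈ a∈ ba) (ℕ.<-asym a<b)

    position : Fin (n ℕ.+ n) → Fin (n ℕ.+ n)
    position c = fromℕ< (rank< (enum-entry c))

    position-injective : Injective _≡_ _≡_ position
    position-injective eq = oneLine-injective (identity n)
      (rank-injective (enum-entry _) (enum-entry _) (Fin.fromℕ<-injective _ _ _ _ eq))

    at : Fin (n ℕ.+ n) → ℤ
    at k = enum (proj₁ (Fin-injective⇒surjective position-injective k))

    at-entry : ∀ k → Entry n (at k)
    at-entry k = enum-entry _

    rank-at : ∀ k → rank (at k) ≡ toℕ k
    rank-at k with c , eq ← Fin-injective⇒surjective position-injective k =
      trans (sym (Fin.toℕ-fromℕ< _)) (cong toℕ eq)

    at-injective : Injective _≡_ _≡_ at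
    at-injective {k} {l} eq = Fin.toℕ-injective (trans (sym (rank-at k)) (trans (cong rank eq) (rank-at l)))

    at-opposite : ∀ k → at (opposite k) ≡ - at k
    at-opposite k = rank-injective (at-entry (opposite k)) (Entry-neg (at-entry k)) (begin
      rank (at (opposite k))        ≡⟨ rank-at (opposite k) ⟩
      toℕ (opposite k)              ≡⟨ Fin.opposite-prop k ⟩
      (n ℕ.+ n) ℕ.∸ suc (toℕ k)     ≡⟨ cong (λ r → (n ℕ.+ n) ℕ.∸ suc r) (rank-at k) ⟨
      (n ℕ.+ n) ℕ.∸ suc (rank (at k)) ≡⟨ cong (ℕ._∸ suc (rank (at k))) (rank-neg (at-entry k)) ⟨
      rank (- at k) ℕ.+ r+1 ℕ.∸ r+1 ≡⟨ ℕ.m+n∸n≡m (rank (- at k)) r+1 ⟩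
      rank (- at k)                 ∎)
      where
      open ≡-Reasoning
      r+1 : ℕ
      r+1 = suc (rank (at k))

    w : SignedPerm n
    w = record
      { val     = at ∘ (n ↑ʳ_)
      ; inRange = λ i → Entry.nonzero (at-entry (n ↑ʳ i)) , Entry.bounded (at-entry (n ↑ʳ i))
      ; absInj  = λ i j eq → case ∣i∣≡∣j∣⇒i≡j⊎i≡-j _ _ eq of λ where
          (inj₁ eq)  → Fin.↑ʳ-injective n i j (at-injective eq)
          (inj₂ eq′) → contradiction
            (at-injective (trans eq′ (trans (sym (at-opposite (n ↑ʳ j))) (cong at (opposite-↑ʳ j)))))
            (↑ʳ≢↑ˡ i (opposite j))
      }

    oneLine-w : ∀ k → oneLine w k ≡ at k
    oneLine-w k with half n k
    ... | right i = oneLine-↑ʳ w i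
    ... | left i  = begin
      oneLine w (i ↑ˡ n)              ≡⟨ oneLine-↑ˡ w i ⟩
      - at (n ↑ʳ opposite i)          ≡⟨ at-opposite (n ↑ʳ opposite i) ⟨
      at (opposite (n ↑ʳ opposite i)) ≡⟨ cong at (opposite-↑ʳ (opposite i)) ⟩
      at (opposite (opposite i) ↑ˡ n) ≡⟨ cong (at ∘ (_↑ˡ n)) (Fin.opposite-involutive i) ⟩
      at (i ↑ˡ n)                     ∎
      where open ≡-Reasoning

    rank-oneLine-w : ∀ k → rank (oneLine w k) ≡ toℕ k
    rank-oneLine-w k = trans (cong rank (oneLine-w k)) (rank-at k)

    Precedes-w⇔ : Entry n a → Entry n b → Precedes w a b ⇔ R a b
    Precedes-w⇔ {a} {b} a∈ b∈ = mk⇔ to from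
      where
      to : Precedes w a b → R a b
      to (p , q , p<q , refl , refl) =
        rank-<⇒R a∈ b∈ (subst₂ ℕ._<_ (sym (rank-oneLine-w p)) (sym (rank-oneLine-w q)) p<q)
      locate : ∀ {e} → Entry n e → Fin (n ℕ.+ n)
      locate e∈ = fromℕ< (rank< e∈)
      oneLine-locate : ∀ {e} (e∈ : Entry n e) → oneLine w (locate e∈) ≡ e
      oneLine-locate e∈ = rank-injective (oneLine-entry w _) e∈
        (trans (rank-oneLine-w (locate e∈)) (Fin.toℕ-fromℕ< _))
      from : R a b → Precedes w a b
      from ab = locate a∈ , locate b∈
              , subst₂ ℕ._<_ (sym (Fin.toℕ-fromℕ< _)) (sym (Fin.toℕ-fromℕ< _)) (rank-mono a∈ b∈ ab)
              , oneLine-locate a∈ , oneLine-locate b∈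

opaque
  realise : ∀ {R} → IsSignedLinearOrder n R →
            Σ[ w ∈ SignedPerm n ] (∀ {a b} → Entry n a → Entry n b → Precedes w a b ⇔ R a b)
  realise S = Realise.w S , Realise.Precedes-w⇔ S

module _ {R : ℤ → ℤ → Set}
  (irrefl : ∀ {a} → ¬ R a a)
  (asym : ∀ {a b} → R a b → ¬ R b a)
  (total : ∀ {a b} → Entry n a → Entry n b → a ≢ b → R a b ⊎ R b a)
  (no-cycle-from-min : ∀ {lo a b} → Entry n lo → Entry n a → Entry n b →
                       lo ℤ.< a → lo ℤ.< b → R lo a → R a b → R b lo → ⊥)
  where

  no-3-cycle : Entry n a → Entry n b → Entry n c → R a b → R b c → ¬ R c a
  no-3-cycle {a} {b} {c} a∈ b∈ c∈ ab bc ca with ℤ.<-cmp a b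
  ... | tri≈ _ refl _ = irrefl ab
  ... | tri< a<b _ _ with ℤ.<-cmp a c
  ...   | tri< a<c _ _ = no-cycle-from-min a∈ b∈ c∈ a<b a<c ab bc ca
  ...   | tri≈ _ refl _ = irrefl ca
  ...   | tri> _ _ c<a = no-cycle-from-min c∈ a∈ b∈ c<a (ℤ.<-trans c<a a<b) ca ab bc
  no-3-cycle {a} {b} {c} a∈ b∈ c∈ ab bc ca | tri> _ _ b<a with ℤ.<-cmp b c
  ...   | tri< b<c _ _ = no-cycle-from-min b∈ c∈ a∈ b<c b<a bc ca ab
  ...   | tri≈ _ refl _ = irrefl bc
  ...   | tri> _ _ c<b = no-cycle-from-min c∈ a∈ b∈ (ℤ.<-trans c<b b<a) c<b ca ab bc

  transitive-if-acyclic : Entry n a → Entry n b → Entry n c → R a b → R b c → R a c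
  transitive-if-acyclic {a} {b} {c} a∈ b∈ c∈ ab bc with a ℤ.≟ c
  ... | yes refl = contradiction bc (asym ab)
  ... | no a≢c with total a∈ c∈ a≢c
  ...   | inj₁ ac = ac
  ...   | inj₂ ca = contradiction ca (no-3-cycle a∈ b∈ c∈ ab bc)

module _ (o : Orientation n) where

  ±k⇒InD⊎InU : (k : Fin (pred n)) → a ≡ + suc (toℕ k) ⊎ a ≡ - + suc (toℕ k) →
               InD {n} o a ⊎ InU {n} o a
  ±k⇒InD⊎InU k a≡±k with o k in ok | a≡±k
  ... | true  | inj₁ a≡k  = inj₁ (k , inj₁ (a≡k , ok))
  ... | true  | inj₂ a≡-k = inj₂ (k , inj₂ (a≡-k , ok))
  ... | false | inj₁ a≡k  = inj₂ (k , inj₁ (a≡k , ok))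
  ... | false | inj₂ a≡-k = inj₁ (k , inj₂ (a≡-k , ok))

  InD⊎InU : ∀ {lo mid hi} → Entry n lo → Entry n hi → lo ℤ.< mid → mid ℤ.< hi → mid ≢ + 0 →
            InD {n} o mid ⊎ InU {n} o mid
  InD⊎InU {mid = + zero} _ _ _ _ mid≢0 = contradiction refl mid≢0
  InD⊎InU {mid = +[1+ m ]} {+[1+ h ]} _ (entry _ h<n) _ (+<+ (s≤s m<h)) _ =
    ±k⇒InD⊎InU (fromℕ< k<n-1) (inj₁ (cong (λ k → +[1+ k ]) (sym (Fin.toℕ-fromℕ< k<n-1))))
    where
    k<n-1 : m ℕ.< pred n
    k<n-1 = ℕ.≤-trans m<h (ℕ.<⇒≤pred h<n)
  InD⊎InU {lo = -[1+ l ]} {mid = -[1+ m ]} (entry _ l<n) _ (ℤ.-<- m<l) _ _ =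
    ±k⇒InD⊎InU (fromℕ< k<n-1) (inj₂ (cong (λ k → -[1+ k ]) (sym (Fin.toℕ-fromℕ< k<n-1))))
    where
    k<n-1 : m ℕ.< pred n
    k<n-1 = ℕ.≤-trans m<l (ℕ.<⇒≤pred l<n)

  module _ {π : SignedPerm n} (π∈𝓣 : In𝓣 o π) {lo mid hi : ℤ}
           (lo<mid : lo ℤ.< mid) (mid<hi : mid ℤ.< hi) where

    In𝓣⇒¬InD-132 : Precedes π lo hi → Precedes π hi mid → ¬ InD {n} o mid
    In𝓣⇒¬InD-132 lo≺hi hi≺mid mid∈D
      with p , q , r , p<q , q<r , refl , refl , refl ← Precedes-chain π lo≺hi hi≺mid =
      proj₂ π∈𝓣 (p , q , r , p<q , q<r , lo<mid , mid<hi , mid∈D)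

    In𝓣⇒¬InU-213 : Precedes π mid lo → Precedes π lo hi → ¬ InU {n} o mid
    In𝓣⇒¬InU-213 mid≺lo lo≺hi mid∈U
      with p , q , r , p<q , q<r , refl , refl , refl ← Precedes-chain π mid≺lo lo≺hi =
      proj₁ π∈𝓣 (p , q , r , p<q , q<r , lo<mid , mid<hi , mid∈U)

  In𝓣-132-213-incompatible :
    ∀ {π σ : SignedPerm n} {lo mid hi} → In𝓣 o π → In𝓣 o σ →
    Entry n lo → Entry n mid → Entry n hi → lo ℤ.< mid → mid ℤ.< hi →
    Precedes π lo hi → Precedes π hi mid → Precedes σ mid lo → Precedes σ lo hi → ⊥
  In𝓣-132-213-incompatible π∈𝓣 σ∈𝓣 lo∈ mid∈ hi∈ lo<mid mid<hi
                           π-lo≺hi π-hi≺mid σ-mid≺lo σ-lo≺hi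
    with InD⊎InU lo∈ hi∈ lo<mid mid<hi (Entry⇒≢0 mid∈)
  ... | inj₁ mid∈D = In𝓣⇒¬InD-132 π∈𝓣 lo<mid mid<hi π-lo≺hi π-hi≺mid mid∈D
  ... | inj₂ mid∈U = In𝓣⇒¬InU-213 σ∈𝓣 lo<mid mid<hi σ-mid≺lo σ-lo≺hi mid∈U

module _ (x y : SignedPerm n) where

  JoinOrder : ℤ → ℤ → Set
  JoinOrder a b = b ℤ.< a × (Precedes x a b ⊎ Precedes y a b) ⊎ a ℤ.< b × Precedes x a b × Precedes y a b

  JoinOrder? : ∀ a b → Dec (JoinOrder a b)
  JoinOrder? a b = b ℤ.<? a ×-dec (Precedes? x a b ⊎-dec Precedes? y a b)
                ⊎-dec a ℤ.<? b ×-dec Precedes? x a b ×-dec Precedes? y a b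

  JoinOrder-irrefl : ¬ JoinOrder a a
  JoinOrder-irrefl (inj₁ (a<a , _)) = ℤ.<-irrefl refl a<a
  JoinOrder-irrefl (inj₂ (a<a , _)) = ℤ.<-irrefl refl a<a

  JoinOrder-asym : JoinOrder a b → ¬ JoinOrder b a
  JoinOrder-asym (inj₁ (b<a , _))          (inj₁ (a<b , _))          = ℤ.<-asym b<a a<b
  JoinOrder-asym (inj₂ (a<b , _))          (inj₂ (b<a , _))          = ℤ.<-asym b<a a<b
  JoinOrder-asym (inj₁ (_ , inj₁ x-a≺b))   (inj₂ (_ , x-b≺a , _))    = Precedes-asym x x-a≺b x-b≺a
  JoinOrder-asym (inj₁ (_ , inj₂ y-a≺b))   (inj₂ (_ , _ , y-b≺a))    = Precedes-asym y y-a≺b y-b≺a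
  JoinOrder-asym (inj₂ (_ , x-a≺b , _))    (inj₁ (_ , inj₁ x-b≺a))   = Precedes-asym x x-a≺b x-b≺a
  JoinOrder-asym (inj₂ (_ , _ , y-a≺b))    (inj₁ (_ , inj₂ y-b≺a))   = Precedes-asym y y-a≺b y-b≺a

  JoinOrder-total : Entry n a → Entry n b → a ≢ b → JoinOrder a b ⊎ JoinOrder b a
  JoinOrder-total {a} {b} a∈ b∈ a≢b
    with ℤ.<-cmp a b | Precedes-total x a∈ b∈ a≢b | Precedes-total y a∈ b∈ a≢b
  ... | tri≈ _ a≡b _ | _           | _           = contradiction a≡b a≢b
  ... | tri< a<b _ _ | inj₁ x-a≺b  | inj₁ y-a≺b  = inj₁ (inj₂ (a<b , x-a≺b , y-a≺b))
  ... | tri< a<b _ _ | inj₂ x-b≺a  | _           = inj₂ (inj₁ (a<b , inj₁ x-b≺a))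
  ... | tri< a<b _ _ | inj₁ _      | inj₂ y-b≺a  = inj₂ (inj₁ (a<b , inj₂ y-b≺a))
  ... | tri> _ _ b<a | inj₁ x-a≺b  | _           = inj₁ (inj₁ (b<a , inj₁ x-a≺b))
  ... | tri> _ _ b<a | inj₂ _      | inj₁ y-a≺b  = inj₁ (inj₁ (b<a , inj₂ y-a≺b))
  ... | tri> _ _ b<a | inj₂ x-b≺a  | inj₂ y-b≺a  = inj₂ (inj₂ (b<a , x-b≺a , y-b≺a))

  JoinOrder-neg : JoinOrder a b → JoinOrder (- b) (- a)
  JoinOrder-neg (inj₁ (b<a , a≺b)) =
    inj₁ (ℤ.neg-mono-< b<a , Data.Sum.map (Precedes-neg x) (Precedes-neg y) a≺b)
  JoinOrder-neg (inj₂ (a<b , x-a≺b , y-a≺b)) =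
    inj₂ (ℤ.neg-mono-< a<b , Precedes-neg x x-a≺b , Precedes-neg y y-a≺b)

  module _ (o : Orientation n) (x∈𝓣 : In𝓣 o x) (y∈𝓣 : In𝓣 o y) where

    JoinOrder-no-cycle-from-min : ∀ {lo a b} → Entry n lo → Entry n a → Entry n b → lo ℤ.< a → lo ℤ.< b →
                                  JoinOrder lo a → JoinOrder a b → ¬ JoinOrder b lo
    JoinOrder-no-cycle-from-min _ _ _ lo<a _ (inj₁ (a<lo , _)) _ _ = ℤ.<-asym lo<a a<lo
    JoinOrder-no-cycle-from-min _ _ _ _ lo<b _ _ (inj₂ (b<lo , _)) = ℤ.<-asym lo<b b<lo
    JoinOrder-no-cycle-from-min lo∈ a∈ b∈ lo<a lo<b (inj₂ (_ , x-lo≺a , y-lo≺a)) a≺b (inj₁ (_ , b≺lo))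
      with a≺b | b≺lo
    ... | inj₂ (_ , x-a≺b , _) | inj₁ x-b≺lo = Precedes-asym x (Precedes-trans x x-lo≺a x-a≺b) x-b≺lo
    ... | inj₂ (_ , _ , y-a≺b) | inj₂ y-b≺lo = Precedes-asym y (Precedes-trans y y-lo≺a y-a≺b) y-b≺lo
    ... | inj₁ (_ , inj₁ x-a≺b) | inj₁ x-b≺lo = Precedes-asym x (Precedes-trans x x-lo≺a x-a≺b) x-b≺lo
    ... | inj₁ (_ , inj₂ y-a≺b) | inj₂ y-b≺lo = Precedes-asym y (Precedes-trans y y-lo≺a y-a≺b) y-b≺lo
    ... | inj₁ (b<a , inj₁ x-a≺b) | inj₂ y-b≺lo =
      In𝓣-132-213-incompatible o x∈𝓣 y∈𝓣 lo∈ b∈ a∈ lo<b b<a x-lo≺a x-a≺b y-b≺lo y-lo≺a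
    ... | inj₁ (b<a , inj₂ y-a≺b) | inj₁ x-b≺lo =
      In𝓣-132-213-incompatible o y∈𝓣 x∈𝓣 lo∈ b∈ a∈ lo<b b<a y-lo≺a y-a≺b x-b≺lo x-lo≺a

    JoinOrder-isSignedLinearOrder : IsSignedLinearOrder n JoinOrder
    JoinOrder-isSignedLinearOrder = record
      { R?         = JoinOrder?
      ; irrefl     = JoinOrder-irrefl
      ; transitive = transitive-if-acyclic JoinOrder-irrefl JoinOrder-asym JoinOrder-total
                                           JoinOrder-no-cycle-from-min
      ; total      = JoinOrder-total
      ; neg        = JoinOrder-neg
      }

IsRoot : ℕ → Root → Set
IsRoot n (e i)       = 1 ≤ i × i ≤ n
IsRoot n (eDiff j i) = 1 ≤ i × i ℕ.< j × j ≤ n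
IsRoot n (eSum j i)  = 1 ≤ i × i ℕ.< j × j ≤ n

<⇒1≤ : ∀ {i j} → i ℕ.< j → 1 ≤ j
<⇒1≤ (s≤s _) = s≤s ℕ.z≤n

<-≤⇒≤ : ∀ {i j} → i ℕ.< j → j ≤ n → i ≤ n
<-≤⇒≤ i<j j≤n = ℕ.≤-trans (ℕ.<⇒≤ i<j) j≤n

higher lower : Root → ℤ
higher (e i)       = + i
higher (eDiff j i) = + j
higher (eSum j i)  = + i
lower (e i)        = - + i
lower (eDiff j i)  = + i
lower (eSum j i)   = - + j

lower<higher : ∀ r → IsRoot n r → lower r ℤ.< higher r
lower<higher (e (suc i))            _             = ℤ.-<+
lower<higher (eDiff j i)            (_ , i<j , _) = +<+ i<j
lower<higher (eSum (suc j) (suc i)) _             = ℤ.-<+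

root-entries : ∀ r → IsRoot n r → Entry n (higher r) × Entry n (lower r)
root-entries (e i)       (1≤i , i≤n)       = entry 1≤i i≤n , Entry-neg (entry 1≤i i≤n)
root-entries (eDiff j i) (1≤i , i<j , j≤n) = entry (<⇒1≤ i<j) j≤n , entry 1≤i (<-≤⇒≤ i<j j≤n)
root-entries (eSum j i)  (1≤i , i<j , j≤n) =
  entry 1≤i (<-≤⇒≤ i<j j≤n) , Entry-neg (entry (<⇒1≤ i<j) j≤n)

module _ {π : SignedPerm n} where

  Inv⇒Precedes : ∀ r → Inv π r → IsRoot n r × Precedes π (higher r) (lower r)
  Inv⇒Precedes (e i)       (1≤i , i≤n , ≺)       = (1≤i , i≤n) , ≺
  Inv⇒Precedes (eDiff j i) (1≤i , i<j , j≤n , ≺) = (1≤i , i<j , j≤n) , ≺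
  Inv⇒Precedes (eSum j i)  (1≤i , i<j , j≤n , ≺) = (1≤i , i<j , j≤n) , ≺

  Precedes⇒Inv : ∀ r → IsRoot n r → Precedes π (higher r) (lower r) → Inv π r
  Precedes⇒Inv (e i)       (1≤i , i≤n)       ≺ = 1≤i , i≤n , ≺
  Precedes⇒Inv (eDiff j i) (1≤i , i<j , j≤n) ≺ = 1≤i , i<j , j≤n , ≺
  Precedes⇒Inv (eSum j i)  (1≤i , i<j , j≤n) ≺ = 1≤i , i<j , j≤n , ≺

≤w-intro : {π σ : SignedPerm n} → (∀ {a b} → b ℤ.< a → Precedes π a b → Precedes σ a b) → π ≤w σ
≤w-intro π⇒σ r r∈Iπ with r-root , ≺ ← Inv⇒Precedes r r∈Iπ =
  Precedes⇒Inv r r-root (π⇒σ (lower<higher r r-root) ≺)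

module _ (o : Orientation n) {x y : SignedPerm n} (x∈𝓣 : In𝓣 o x) (y∈𝓣 : In𝓣 o y) where

  join : SignedPerm n
  join = proj₁ (realise (JoinOrder-isSignedLinearOrder x y o x∈𝓣 y∈𝓣))

  Precedes-join⇔ : Entry n a → Entry n b → Precedes join a b ⇔ JoinOrder x y a b
  Precedes-join⇔ = proj₂ (realise (JoinOrder-isSignedLinearOrder x y o x∈𝓣 y∈𝓣))

  join-keeps : b ℤ.< a → Precedes x a b ⊎ Precedes y a b → Precedes join a b
  join-keeps b<a x∨y =
    Equivalence.from (uncurry Precedes-join⇔ ([ Precedes-entries x , Precedes-entries y ]′ x∨y))
                     (inj₁ (b<a , x∨y))

  Inv-join⇔ : ∀ r → Inv join r ⇔ (Inv x r ⊎ Inv y r)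
  Inv-join⇔ r = mk⇔ to
    [ ≤w-intro (λ b<a → join-keeps b<a ∘ inj₁) r , ≤w-intro (λ b<a → join-keeps b<a ∘ inj₂) r ]′
    where
    to : Inv join r → Inv x r ⊎ Inv y r
    to r∈I with r-root , ≺ ← Inv⇒Precedes r r∈I
                with Equivalence.to (uncurry Precedes-join⇔ (Precedes-entries join ≺)) ≺
    ... | inj₁ (_ , inj₁ x≺) = inj₁ (Precedes⇒Inv r r-root x≺)
    ... | inj₁ (_ , inj₂ y≺) = inj₂ (Precedes⇒Inv r r-root y≺)
    ... | inj₂ (higher<lower , _) = contradiction higher<lower (ℤ.<-asym (lower<higher r r-root))

join-inversions : (o : Orientation n) (x y z : SignedPerm n) → In𝓣 o x → In𝓣 o y → IsJoin x y z →
                  ∀ r → Inv z r ⇔ (Inv x r ⊎ Inv y r)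
join-inversions o x y z x∈𝓣 y∈𝓣 (x≤z , y≤z , least) r =
  mk⇔ (Equivalence.to (Inv-join⇔ o x∈𝓣 y∈𝓣 r) ∘ least (join o x∈𝓣 y∈𝓣) x≤join y≤join r)
      [ x≤z r , y≤z r ]′
  where
  x≤join : x ≤w join o x∈𝓣 y∈𝓣
  x≤join r = Equivalence.from (Inv-join⇔ o x∈𝓣 y∈𝓣 r) ∘ inj₁
  y≤join : y ≤w join o x∈𝓣 y∈𝓣
  y≤join r = Equivalence.from (Inv-join⇔ o x∈𝓣 y∈𝓣 r) ∘ inj₂

negate : SignedPerm n → SignedPerm n
negate π = record
  { val     = -_ ∘ val π
  ; inRange = λ i → Entry.nonzero (Entry-neg (val-entry π i)) , Entry.bounded (Entry-neg (val-entry π i))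
  ; absInj  = λ i j eq →
      absInj π i j (trans (sym (ℤ.∣-i∣≡∣i∣ (val π i))) (trans eq (ℤ.∣-i∣≡∣i∣ (val π j))))
  }

oneLine-negate : (π : SignedPerm n) → ∀ k → oneLine (negate π) k ≡ - oneLine π k
oneLine-negate {n} π k with splitAt n k
... | inj₁ _ = refl
... | inj₂ _ = refl

module _ (π : SignedPerm n) where

  Precedes-neg⇔ : Precedes π (- a) (- b) ⇔ Precedes π b a
  Precedes-neg⇔ {a} {b} = mk⇔
    (subst₂ (Precedes π) (ℤ.neg-involutive b) (ℤ.neg-involutive a) ∘ Precedes-neg π)
    (Precedes-neg π)

  Precedes-negate : Precedes π a b → Precedes (negate π) (- a) (- b)
  Precedes-negate (p , q , p<q , refl , refl) = p , q , p<q , oneLine-negate π p , oneLine-negate π q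

  Precedes-unnegate : Precedes (negate π) a b → Precedes π (- a) (- b)
  Precedes-unnegate (p , q , p<q , refl , refl) = p , q , p<q , unnegate p , unnegate q
    where
    unnegate : ∀ k → oneLine π k ≡ - oneLine (negate π) k
    unnegate k = sym (trans (cong -_ (oneLine-negate π k)) (ℤ.neg-involutive _))

  Precedes-negate⇔ : Precedes (negate π) a b ⇔ Precedes π b a
  Precedes-negate⇔ {a} {b} = mk⇔
    (Equivalence.to Precedes-neg⇔ ∘ Precedes-unnegate)
    (subst₂ (Precedes (negate π)) (ℤ.neg-involutive a) (ℤ.neg-involutive b) ∘
       Precedes-negate ∘ Precedes-neg π)

  Inv-negate-exclusive : ∀ r → Inv π r → ¬ Inv (negate π) r
  Inv-negate-exclusive r r∈Iπ r∈I-π = Precedes-asym π (proj₂ (Inv⇒Precedes r r∈Iπ))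
    (Equivalence.to Precedes-negate⇔ (proj₂ (Inv⇒Precedes r r∈I-π)))

  Inv⊎Inv-negate : ∀ r → IsRoot n r → Inv π r ⊎ Inv (negate π) r
  Inv⊎Inv-negate r r-root
    with Precedes-total π (proj₁ (root-entries r r-root)) (proj₂ (root-entries r r-root))
                          (ℤ.<⇒≢ (lower<higher r r-root) ∘ sym)
  ... | inj₁ h≺l = inj₁ (Precedes⇒Inv r r-root h≺l)
  ... | inj₂ l≺h = inj₂ (Precedes⇒Inv r r-root (Equivalence.from Precedes-negate⇔ l≺h))

≤w-trans : {π σ τ : SignedPerm n} → π ≤w σ → σ ≤w τ → π ≤w τ
≤w-trans π≤σ σ≤τ r = σ≤τ r ∘ π≤σ r

negate-antitone : {π σ : SignedPerm n} → π ≤w σ → negate σ ≤w negate π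
negate-antitone {π = π} {σ} π≤σ r r∈I-σ with Inv⊎Inv-negate π r (proj₁ (Inv⇒Precedes r r∈I-σ))
... | inj₁ r∈Iπ  = contradiction r∈I-σ (Inv-negate-exclusive σ r (π≤σ r r∈Iπ))
... | inj₂ r∈I-π = r∈I-π

negate-involutive : {π : SignedPerm n} → negate (negate π) ≤w π
negate-involutive {π = π} = ≤w-intro λ _ →
  Equivalence.to (Precedes-negate⇔ π) ∘ Equivalence.to (Precedes-negate⇔ (negate π))

negate-≤w-swap : {π σ : SignedPerm n} → negate π ≤w σ → negate σ ≤w π
negate-≤w-swap -π≤σ = ≤w-trans (negate-antitone -π≤σ) negate-involutive

IsMeet⇒IsJoin-negate : {x y z : SignedPerm n} → IsMeet x y z → IsJoin (negate x) (negate y) (negate z)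
IsMeet⇒IsJoin-negate (z≤x , z≤y , greatest) =
  negate-antitone z≤x , negate-antitone z≤y ,
  λ w -x≤w -y≤w → negate-≤w-swap (greatest (negate w) (negate-≤w-swap -x≤w) (negate-≤w-swap -y≤w))

module _ (o : Orientation n) where

  InU-flip : InU {n} (not ∘ o) (- a) → InU {n} o a
  InU-flip (k , inj₁ (-a≡k , ok))  = k , inj₂ (-a≡b⇒a≡-b -a≡k , not-injective {y = true} ok)
  InU-flip (k , inj₂ (-a≡-k , ok)) =
    k , inj₁ (trans (-a≡b⇒a≡-b -a≡-k) (ℤ.neg-involutive _) , not-injective {y = false} ok)

  InD-flip : InD {n} (not ∘ o) (- a) → InD {n} o a
  InD-flip (k , inj₁ (-a≡k , ok))  = k , inj₂ (-a≡b⇒a≡-b -a≡k , not-injective {y = false} ok)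
  InD-flip (k , inj₂ (-a≡-k , ok)) =
    k , inj₁ (trans (-a≡b⇒a≡-b -a≡-k) (ℤ.neg-involutive _) , not-injective {y = true} ok)

  In𝓑⇒In𝓣-negate : (π : SignedPerm n) → In𝓑 o π → In𝓣 (not ∘ o) (negate π)
  In𝓑⇒In𝓣-negate π (no-231 , no-312) = no-213 , no-132
    where
    flip-< : ∀ {k l} → oneLine (negate π) k ℤ.< oneLine (negate π) l → oneLine π l ℤ.< oneLine π k
    flip-< {k} {l} = ℤ.neg-cancel-< ∘ subst₂ ℤ._<_ (oneLine-negate π k) (oneLine-negate π l)
    no-213 : ¬ Contains-bar213 (not ∘ o) (negate π)
    no-213 (p , q , r , p<q , q<r , q<p , p<r , p∈U) =
      no-231 (p , q , r , p<q , q<r , flip-< p<r , flip-< q<p ,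
              InU-flip (subst (InU {n} (not ∘ o)) (oneLine-negate π p) p∈U))
    no-132 : ¬ Contains-13under2 (not ∘ o) (negate π)
    no-132 (p , q , r , p<q , q<r , p<r , r<q , r∈D) =
      no-312 (p , q , r , p<q , q<r , flip-< r<q , flip-< p<r ,
              InD-flip (subst (InD {n} (not ∘ o)) (oneLine-negate π r) r∈D))

meet-inversions : (o : Orientation n) (x y z : SignedPerm n) → In𝓑 o x → In𝓑 o y → IsMeet x y z →
                  ∀ r → Inv z r ⇔ (Inv x r × Inv y r)
meet-inversions o x y z x∈𝓑 y∈𝓑 z-meet@(z≤x , z≤y , _) r =
  mk⇔ (λ r∈Iz → z≤x r r∈Iz , z≤y r r∈Iz) from
  where
  negated-join : Inv (negate z) r → Inv (negate x) r ⊎ Inv (negate y) r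
  negated-join = Equivalence.to (join-inversions (not ∘ o) (negate x) (negate y) (negate z)
    (In𝓑⇒In𝓣-negate o x x∈𝓑) (In𝓑⇒In𝓣-negate o y y∈𝓑) (IsMeet⇒IsJoin-negate z-meet) r)
  from : Inv x r × Inv y r → Inv z r
  from (r∈Ix , r∈Iy) = case Inv⊎Inv-negate z r (proj₁ (Inv⇒Precedes r r∈Ix)) of λ where
    (inj₁ r∈Iz)  → r∈Iz
    (inj₂ r∈I-z) → case negated-join r∈I-z of λ where
      (inj₁ r∈I-x) → contradiction r∈I-x (Inv-negate-exclusive x r r∈Ix)
      (inj₂ r∈I-y) → contradiction r∈I-y (Inv-negate-exclusive y r r∈Iy)

lemma12 : (n : ℕ) → 2 ≤ n → (o : Orientation n) →
    ((x y z : SignedPerm n) → In𝓣 o x → In𝓣 o y → IsJoin x y z →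
       ∀ r → Inv z r ⇔ (Inv x r ⊎ Inv y r))
    × ((x y z : SignedPerm n) → In𝓑 o x → In𝓑 o y → IsMeet x y z →
       ∀ r → Inv z r ⇔ (Inv x r × Inv y r))
lemma12 n _ o = join-inversions o , meet-inversions o
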